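{- Let $p$ be an odd prime, let $\mathcal{O}$ be an imaginary quadratic order of discriminant $\Delta$ with $\left(\frac{\Delta}{p}\right)\neq1$, let $a\in\mathbb{Z}^+$, and let $P\in\mathcal{O}/p^a\mathcal{O}$ be an element of additive order $p^a$. Suppose that for some integer $0\le m\le a$ the $C_{p^m}(\mathcal{O})$-orbit of $p^{a-m}P$, viewed as an element of $\mathcal{O}/p^m\mathcal{O}$, has size greater than $\varphi(p^m)$. Then the size of the $C_{p^a}(\mathcal{O})$-orbit of $P$ equals $p^{2(a-m)}$ times the size of the $C_{p^m}(\mathcal{O})$-orbit of $p^{a-m}P$.
   Context: $C_N(\mathcal{O}):=(\mathcal{O}/N\mathcal{O})^\times$ acting on $\mathcal{O}/N\mathcal{O}$ by multiplication. The element $p^{a-m}P$ lies in $p^{a-m}\mathcal{O}/p^a\mathcal{O}$, which is identified with $\mathcal{O}/p^m\mathcal{O}$ via the $\mathcal{O}$-module isomorphism $\mathcal{O}/p^m\mathcal{O}\to p^{a-m}\mathcal{O}/p^a\mathcal{O}$, $x\mapsto p^{a-m}x$. $\varphi$ is Euler's totient function. -}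

module Defs where

open import Data.Bool using (Bool; _∧_)
open import Data.Nat as ℕ using (ℕ; suc; _≡ᵇ_)
open import Data.Nat.GCD using (gcd)
open import Data.Integer using (ℤ; +_; _+_; _-_; _*_)
open import Data.Integer.DivMod using (_/_)
open import Data.Integer.Divisibility.Signed using (_∣_; _∣?_)
open import Data.List using (List; map; concatMap; upTo; applyUpTo; filterᵇ; length)
open import Data.Bool.ListAction using (any)
open import Data.Product using (_×_; _,_; ∃)
open import Relation.Nullary using (¬_; does)

-- Imaginary quadratic order of discriminant Δ:  𝒪 = ℤ[ω],  ω = (Δ + √Δ)/2,
-- so ω² = Δ ω - (Δ² - Δ)/4.  An element x + y ω is represented by (x , y).
El : Set
El = ℤ × ℤ

-- constant term: ω² = Δ ω - cst Δ
cst : ℤ → ℤ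
cst Δ = (Δ * Δ - Δ) / (+ 4)

IsImagQuadDisc : ℤ → Set
IsImagQuadDisc Δ = (Δ Data.Integer.< + 0) × ((+ 4 ∣ Δ) Data.Sum.⊎ (+ 4 ∣ (Δ - + 1)))
  where import Data.Sum

mulO : ℤ → El → El → El
mulO Δ (a , b) (c , d) = (a * c - b * d * cst Δ , a * d + b * c + b * d * Δ)

smul : ℤ → El → El
smul k (a , b) = (k * a , k * b)

_≡O_[mod_] : El → El → ℕ → Set
(a , b) ≡O (c , d) [mod N ] = (+ N ∣ (a - c)) × (+ N ∣ (b - d))

congO? : ℕ → El → El → Bool
congO? N (a , b) (c , d) = does (+ N ∣? (a - c)) ∧ does (+ N ∣? (b - d))

reps : ℕ → List El
reps N = concatMap (λ i → map (λ j → (+ i , + j)) (upTo N)) (upTo N)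

isUnit? : ℤ → ℕ → El → Bool
isUnit? Δ N u = any (λ w → congO? N (mulO Δ u w) (+ 1 , + 0)) (reps N)

-- x lies in the C_N(𝒪) = (𝒪/N𝒪)^×-orbit of P
inOrbit? : ℤ → ℕ → El → El → Bool
inOrbit? Δ N P x = any (λ u → isUnit? Δ N u ∧ congO? N (mulO Δ u P) x) (reps N)

orbitSize : ℤ → ℕ → El → ℕ
orbitSize Δ N P = length (filterᵇ (inOrbit? Δ N P) (reps N))

φ : ℕ → ℕ
φ n = length (filterᵇ (λ k → gcd k n ≡ᵇ 1) (applyUpTo suc n))

HasAdditiveOrder : ℕ → El → ℕ → Set
HasAdditiveOrder N P k =
  (0 ℕ.< k) × (smul (+ k) P ≡O (+ 0 , + 0) [mod N ]) ×
  (∀ j → 0 ℕ.< j → j ℕ.< k → ¬ (smul (+ j) P ≡O (+ 0 , + 0) [mod N ]))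

LegendreIsOne : ℤ → ℕ → Set
LegendreIsOne Δ p = ¬ (+ p ∣ Δ) × ∃ λ x → + p ∣ (x * x - Δ)

-- Write N for the norm form, so that u · ū = N(u). Modulo p^k (k ≥ 1) the units of 𝒪 are exactly
-- the elements of norm prime to p, and P is not divisible by p because it has additive order p^a.
--
-- If p^m ∤ N(P), write N(P) = p^e n′ with e < m and p ∤ n′. For a unit u and any z,
-- u·P + p^m z = v·P with v = u + p^(m−e) n′⁻¹ z P̄, again a unit as v ≡ u (mod p). So membership
-- in the orbit of P modulo p^a only depends on the residue modulo p^m: the orbit modulo p^a is the
-- full preimage of the orbit modulo p^m, and it is p^(2(a−m)) times as large.
--
-- If p^m ∣ N(P) with m ≥ 1, then p ∣ Δ, since otherwise 4N(P) = (2x + Δy)² − Δy² would make Δ a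
-- square modulo p; hence p ∣ x and p ∤ y for P = x + yω. Every unit a + bω is then congruent modulo
-- p^m to s + λP̄ with λ = −b y⁻¹ and s ∈ ℤ prime to p, so it maps P to s·P, and the orbit has at
-- most φ(p^m) elements, against the hypothesis. For m = 0 the orbit modulo 1 has one element.

module Submission where

open import Data.Bool using (Bool; true; false; T)
open import Data.Bool.Properties using (T-∧; T-≡; ⇔→≡)
open import Data.Empty using (⊥-elim)
open import Data.Integer as ℤ using (ℤ; +_; 0ℤ; 1ℤ)
open import Data.Integer.DivMod using (_/_; _%ℕ_; _/ℕ_; a≡a%ℕn+[a/ℕn]*n; n%ℕd<d; div-pos-is-/ℕ)
open import Data.Integer.Divisibility.Signed
import Data.Integer.Properties as ℤ
open import Data.Integer.Tactic.RingSolver using (solve-∀)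
open import Data.List using (List; []; _∷_; _++_; length; map; filterᵇ; applyUpTo; upTo; concatMap; cartesianProductWith)
open import Data.List.Membership.Propositional using (_∈_; find; lose)
open import Data.List.Membership.Propositional.Properties
  using (∈-cartesianProductWith⁺; ∈-cartesianProductWith⁻; ∈-upTo⁺; ∈-upTo⁻; ∈-filter⁺; ∈-filter⁻; ∈-map⁺; ∈-applyUpTo⁺)
open import Data.List.Properties using (length-++; filter-++; map-applyUpTo; length-removeAt′; length-map; length-filter)
open import Data.List.Relation.Binary.Subset.Propositional using (_⊆_)
import Data.List.Relation.Unary.All as All
open import Data.List.Relation.Unary.Any using (here; there; _─_; index)
open import Data.List.Relation.Unary.Any.Properties using (any⁺; any⁻)
open import Data.List.Relation.Unary.Unique.Propositional using (Unique; _∷_)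
import Data.List.Relation.Unary.Unique.Propositional.Properties as Unique
open import Data.Nat as ℕ using (ℕ; zero; suc; NonZero; z≤n; s≤s; _≤_; _<_; _^_)
open import Data.Nat.Coprimality using (Coprime; coprime-divisor; coprime-Bézout; coprime⇒gcd≡1)
import Data.Nat.Divisibility as ℕ
open import Data.Nat.DivMod using ([m+n]%n≡m%n; m<n⇒m%n≡m)
open import Data.Nat.GCD using (gcd; module Bézout)
open import Data.Nat.Primality using (Prime; euclidsLemma; prime⇒irreducible; prime⇒nonZero; prime⇒nonTrivial)
import Data.Nat.Properties as ℕ
open import Data.Product using (_×_; _,_; proj₁; proj₂; ∃-syntax)
open import Data.Sum using (_⊎_; inj₁; inj₂; [_,_]′)
open import Function using (_∘_; id; flip; _⇔_; mk⇔; Equivalence)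
import Function.Properties.Equivalence as ⇔
open import Level using (0ℓ)
open import Relation.Binary.Bundles using (Setoid)
open import Relation.Binary.PropositionalEquality
open import Relation.Nullary using (¬_; Dec; yes; no; does; contradiction)
open import Relation.Nullary.Decidable using (T?)

open import Defs

-- The integer operators are opened only in this block: the theorem is stated with those of ℕ.
module _ where
  open import Data.Integer using (_+_; _-_; _*_; -_)

  -- Congruences modulo n

  infix 4 _≋_[mod_] _≈_[mod_]

  record _≋_[mod_] (a b : ℤ) (n : ℕ) : Set where
    constructor mk≋
    field ∣-diff : + n ∣ a - b
  open _≋_[mod_] public

  module _ {n : ℕ} where

    ∣-≡ : ∀ {a b} → a ≡ b → + n ∣ b → + n ∣ a
    ∣-≡ refl d = d

    ≋-reflexive : ∀ {a b} → a ≡ b → a ≋ b [mod n ]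
    ≋-reflexive {a} refl = mk≋ (divides 0ℤ (a-a≡0 a (+ n)))
      where
      a-a≡0 : ∀ a n → a - a ≡ 0ℤ * n
      a-a≡0 = solve-∀

    ≋-refl : ∀ {a} → a ≋ a [mod n ]
    ≋-refl = ≋-reflexive refl

    ≋-sym : ∀ {a b} → a ≋ b [mod n ] → b ≋ a [mod n ]
    ≋-sym {a} {b} (mk≋ d) = mk≋ (∣-≡ (swap a b) (∣m⇒∣-m d))
      where
      swap : ∀ a b → b - a ≡ - (a - b)
      swap = solve-∀

    ≋-trans : ∀ {a b c} → a ≋ b [mod n ] → b ≋ c [mod n ] → a ≋ c [mod n ]
    ≋-trans {a} {b} {c} (mk≋ d) (mk≋ e) = mk≋ (∣-≡ (split a b c) (∣m∣n⇒∣m+n d e))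
      where
      split : ∀ a b c → a - c ≡ (a - b) + (b - c)
      split = solve-∀

    ≋-+ : ∀ {a b c d} → a ≋ b [mod n ] → c ≋ d [mod n ] → a + c ≋ b + d [mod n ]
    ≋-+ {a} {b} {c} {d} (mk≋ h) (mk≋ k) = mk≋ (∣-≡ (split a b c d) (∣m∣n⇒∣m+n h k))
      where
      split : ∀ a b c d → (a + c) - (b + d) ≡ (a - b) + (c - d)
      split = solve-∀

    ≋-- : ∀ {a b c d} → a ≋ b [mod n ] → c ≋ d [mod n ] → a - c ≋ b - d [mod n ]
    ≋-- {a} {b} {c} {d} (mk≋ h) (mk≋ k) = mk≋ (∣-≡ (split a b c d) (∣m∣n⇒∣m-n h k))
      where
      split : ∀ a b c d → (a - c) - (b - d) ≡ (a - b) - (c - d)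
      split = solve-∀

    ≋-* : ∀ {a b c d} → a ≋ b [mod n ] → c ≋ d [mod n ] → a * c ≋ b * d [mod n ]
    ≋-* {a} {b} {c} {d} (mk≋ h) (mk≋ k) =
      mk≋ (∣-≡ (split a b c d) (∣m∣n⇒∣m+n (∣m⇒∣m*n c h) (∣n⇒∣m*n b k)))
      where
      split : ∀ a b c d → a * c - b * d ≡ (a - b) * c + b * (c - d)
      split = solve-∀

    ≋-∣ : ∀ {a b} → a ≋ b [mod n ] → + n ∣ b → + n ∣ a
    ≋-∣ {a} {b} (mk≋ h) k = ∣-≡ (split a b) (∣m∣n⇒∣m+n h k)
      where
      split : ∀ a b → a ≡ (a - b) + b
      split = solve-∀

  ≋-weaken : ∀ {m n a b} → m ℕ.∣ n → a ≋ b [mod n ] → a ≋ b [mod m ]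
  ≋-weaken m∣n (mk≋ d) = mk≋ (∣-trans (∣ᵤ⇒∣ m∣n) d)

  record _≈_[mod_] (x y : El) (n : ℕ) : Set where
    constructor _,≈_
    field
      fst≈ : proj₁ x ≋ proj₁ y [mod n ]
      snd≈ : proj₂ x ≋ proj₂ y [mod n ]

  module _ {n : ℕ} where

    ≈-reflexive : ∀ {x y} → x ≡ y → x ≈ y [mod n ]
    ≈-reflexive refl = ≋-refl ,≈ ≋-refl

    ≈-refl : ∀ {x} → x ≈ x [mod n ]
    ≈-refl = ≈-reflexive refl

    ≈-sym : ∀ {x y} → x ≈ y [mod n ] → y ≈ x [mod n ]
    ≈-sym (h ,≈ k) = ≋-sym h ,≈ ≋-sym k

    ≈-trans : ∀ {x y z} → x ≈ y [mod n ] → y ≈ z [mod n ] → x ≈ z [mod n ]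
    ≈-trans (h ,≈ k) (h′ ,≈ k′) = ≋-trans h h′ ,≈ ≋-trans k k′

  ≈-setoid : ℕ → Setoid 0ℓ 0ℓ
  ≈-setoid n = record
    { Carrier       = El
    ; _≈_           = _≈_[mod n ]
    ; isEquivalence = record { refl = ≈-refl ; sym = ≈-sym ; trans = ≈-trans }
    }

  ≈-weaken : ∀ {m n x y} → m ℕ.∣ n → x ≈ y [mod n ] → x ≈ y [mod m ]
  ≈-weaken m∣n (h ,≈ k) = ≋-weaken m∣n h ,≈ ≋-weaken m∣n k

  infixl 6 _⊕_

  _⊕_ : El → El → El
  (a , b) ⊕ (c , d) = (a + c , b + d)

  ι : ℤ → El
  ι k = (k , 0ℤ)

  module _ {n : ℕ} where

    ⊕-cong : ∀ {u u′ v v′} → u ≈ u′ [mod n ] → v ≈ v′ [mod n ] → u ⊕ v ≈ u′ ⊕ v′ [mod n ]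
    ⊕-cong (h₁ ,≈ h₂) (k₁ ,≈ k₂) = ≋-+ h₁ k₁ ,≈ ≋-+ h₂ k₂

    smul-cong : ∀ {k l u v} → k ≋ l [mod n ] → u ≈ v [mod n ] → smul k u ≈ smul l v [mod n ]
    smul-cong h (k₁ ,≈ k₂) = ≋-* h k₁ ,≈ ≋-* h k₂

    ⊕-smul-≈ : ∀ {k} u t → + n ∣ k → u ⊕ smul k t ≈ u [mod n ]
    ⊕-smul-≈ {k} (a , b) (c , d) n∣k =
      mk≋ (∣-≡ (cancel a k c) (∣m⇒∣m*n c n∣k)) ,≈ mk≋ (∣-≡ (cancel b k d) (∣m⇒∣m*n d n∣k))
      where
      cancel : ∀ a k c → (a + k * c) - a ≡ k * c
      cancel = solve-∀

    ι-cong : ∀ {a b} → a ≋ b [mod n ] → ι a ≈ ι b [mod n ]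
    ι-cong h = h ,≈ ≋-refl

  ≈⇒≡⊕smul : ∀ {n x y} → x ≈ y [mod n ] → ∃[ z ] x ≡ y ⊕ smul (+ n) z
  ≈⇒≡⊕smul {n} {x₁ , x₂} {y₁ , y₂} (mk≋ (divides z₁ eq₁) ,≈ mk≋ (divides z₂ eq₂)) =
    (z₁ , z₂) , cong₂ _,_ (shift x₁ y₁ z₁ eq₁) (shift x₂ y₂ z₂ eq₂)
    where
    shift : ∀ x y z → x - y ≡ z * + n → x ≡ y + + n * z
    shift x y z eq = begin
      x                  ≡⟨ split x y ⟩
      y + (x - y)        ≡⟨ cong (λ t → y + t) eq ⟩
      y + z * + n        ≡⟨ cong (λ t → y + t) (ℤ.*-comm z (+ n)) ⟩
      y + + n * z        ∎
      where
      open ≡-Reasoning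
      split : ∀ x y → x ≡ y + (x - y)
      split = solve-∀

  module Order (Δ : ℤ) where

    infixl 7 _·_

    _·_ : El → El → El
    _·_ = mulO Δ

    -- ω̄ = Δ − ω, so the conjugate of a + bω is (a + bΔ) − bω.
    conj : El → El
    conj (a , b) = (a + b * Δ , - b)

    norm : El → ℤ
    norm (a , b) = a * a + Δ * a * b + cst Δ * b * b

    ·-comm : ∀ u v → u · v ≡ v · u
    ·-comm (a , b) (c , d) = cong₂ _,_ (e₁ a b c d (cst Δ)) (e₂ a b c d Δ)
      where
      e₁ : ∀ a b c d C → a * c - b * d * C ≡ c * a - d * b * C
      e₁ = solve-∀
      e₂ : ∀ a b c d D → a * d + b * c + b * d * D ≡ c * b + d * a + d * b * D
      e₂ = solve-∀

    ·-assoc : ∀ u v w → (u · v) · w ≡ u · (v · w)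
    ·-assoc (a , b) (c , d) (e , f) = cong₂ _,_ (e₁ a b c d e f Δ (cst Δ)) (e₂ a b c d e f Δ (cst Δ))
      where
      e₁ : ∀ a b c d e f D C →
        (a * c - b * d * C) * e - (a * d + b * c + b * d * D) * f * C
          ≡ a * (c * e - d * f * C) - b * (c * f + d * e + d * f * D) * C
      e₁ = solve-∀
      e₂ : ∀ a b c d e f D C →
        (a * c - b * d * C) * f + (a * d + b * c + b * d * D) * e + (a * d + b * c + b * d * D) * f * D
          ≡ a * (c * f + d * e + d * f * D) + b * (c * e - d * f * C) + b * (c * f + d * e + d * f * D) * D
      e₂ = solve-∀

    ·-distribʳ-⊕ : ∀ w u v → (u ⊕ v) · w ≡ u · w ⊕ v · w
    ·-distribʳ-⊕ (x , y) (a , b) (c , d) = cong₂ _,_ (e₁ a b c d x y (cst Δ)) (e₂ a b c d x y Δ)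
      where
      e₁ : ∀ a b c d x y C → (a + c) * x - (b + d) * y * C ≡ (a * x - b * y * C) + (c * x - d * y * C)
      e₁ = solve-∀
      e₂ : ∀ a b c d x y D →
        (a + c) * y + (b + d) * x + (b + d) * y * D ≡ (a * y + b * x + b * y * D) + (c * y + d * x + d * y * D)
      e₂ = solve-∀

    ι-· : ∀ k u → ι k · u ≡ smul k u
    ι-· k (a , b) = cong₂ _,_ (e₁ k a b (cst Δ)) (e₂ k a b Δ)
      where
      e₁ : ∀ k a b C → k * a - 0ℤ * b * C ≡ k * a
      e₁ = solve-∀
      e₂ : ∀ k a b D → k * b + 0ℤ * a + 0ℤ * b * D ≡ k * b
      e₂ = solve-∀

    ·-conj : ∀ u → u · conj u ≡ ι (norm u)
    ·-conj (a , b) = cong₂ _,_ (e₁ a b Δ (cst Δ)) (e₂ a b Δ (cst Δ))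
      where
      e₁ : ∀ a b D C → a * (a + b * D) - b * (- b) * C ≡ a * a + D * a * b + C * b * b
      e₁ = solve-∀
      e₂ : ∀ a b D C → a * (- b) + b * (a + b * D) + b * (- b) * D ≡ 0ℤ
      e₂ = solve-∀

    norm-· : ∀ u v → norm (u · v) ≡ norm u * norm v
    norm-· (a , b) (c , d) = e a b c d Δ (cst Δ)
      where
      e : ∀ a b c d D C →
          (a * c - b * d * C) * (a * c - b * d * C) + D * (a * c - b * d * C) * (a * d + b * c + b * d * D)
            + C * (a * d + b * c + b * d * D) * (a * d + b * c + b * d * D)
          ≡ (a * a + D * a * b + C * b * b) * (c * c + D * c * d + C * d * d)
      e = solve-∀

    ι-·-ι : ∀ a b → ι a · ι b ≡ ι (a * b)
    ι-·-ι a b = cong₂ _,_ (e₁ a b (cst Δ)) (e₂ a b Δ)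
      where
      e₁ : ∀ a b C → a * b - 0ℤ * 0ℤ * C ≡ a * b
      e₁ = solve-∀
      e₂ : ∀ a b D → a * 0ℤ + 0ℤ * b + 0ℤ * 0ℤ * D ≡ 0ℤ
      e₂ = solve-∀

    norm-ι1 : norm (ι 1ℤ) ≡ 1ℤ
    norm-ι1 = e Δ (cst Δ)
      where
      e : ∀ D C → 1ℤ * 1ℤ + D * 1ℤ * 0ℤ + C * 0ℤ * 0ℤ ≡ 1ℤ
      e = solve-∀

    module _ {n : ℕ} where

      ·-cong : ∀ {u u′ v v′} → u ≈ u′ [mod n ] → v ≈ v′ [mod n ] → u · v ≈ u′ · v′ [mod n ]
      ·-cong (h₁ ,≈ h₂) (k₁ ,≈ k₂) =
        ≋-- (≋-* h₁ k₁) (≋-* (≋-* h₂ k₂) ≋-refl)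
          ,≈ ≋-+ (≋-+ (≋-* h₁ k₂) (≋-* h₂ k₁)) (≋-* (≋-* h₂ k₂) ≋-refl)

      norm-cong : ∀ {u v} → u ≈ v [mod n ] → norm u ≋ norm v [mod n ]
      norm-cong {_ , _} {_ , _} (h₁ ,≈ h₂) =
        ≋-+ (≋-+ (≋-* h₁ h₁) (≋-* (≋-* (≋-refl {a = Δ}) h₁) h₂)) (≋-* (≋-* (≋-refl {a = cst Δ}) h₂) h₂)

    conj-·-cancel : ∀ z Q → (z · conj Q) · Q ≡ ι (norm Q) · z
    conj-·-cancel z Q = begin
      (z · conj Q) · Q   ≡⟨ ·-assoc z (conj Q) Q ⟩
      z · (conj Q · Q)   ≡⟨ cong (z ·_) (·-comm (conj Q) Q) ⟩
      z · (Q · conj Q)   ≡⟨ cong (z ·_) (·-conj Q) ⟩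
      z · ι (norm Q)     ≡⟨ ·-comm z (ι (norm Q)) ⟩
      ι (norm Q) · z     ∎
      where open ≡-Reasoning

  -- Invertibility modulo powers of a prime

  coprime-* : ∀ {n a b} → Coprime n a → Coprime n b → Coprime n (a ℕ.* b)
  coprime-* n⊥a n⊥b (d∣n , d∣ab) =
    n⊥b (d∣n , coprime-divisor (λ (e∣d , e∣a) → n⊥a (ℕ.∣-trans e∣d d∣n , e∣a)) d∣ab)

  coprime-^ : ∀ {n m} → Coprime n m → ∀ k → Coprime n (m ^ k)
  coprime-^ n⊥m zero    (_ , d∣1) = ℕ.∣1⇒≡1 d∣1
  coprime-^ n⊥m (suc k) = coprime-* n⊥m (coprime-^ n⊥m k)

  abs-invertible⇒invertible : ∀ {n M} →
    (∃[ r ] r * + ℤ.∣ n ∣ ≋ 1ℤ [mod M ]) → ∃[ r ] r * n ≋ 1ℤ [mod M ]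
  abs-invertible⇒invertible {n} (r , h) with ℤ.+∣i∣≡i⊎+∣i∣≡-i n
  ... | inj₁ eq = r , subst (λ t → r * t ≋ 1ℤ [mod _ ]) eq h
  ... | inj₂ eq = - r , ≋-trans (≋-reflexive (flip-sign r n)) (subst (λ t → r * t ≋ 1ℤ [mod _ ]) eq h)
    where
    flip-sign : ∀ r n → (- r) * n ≡ r * (- n)
    flip-sign = solve-∀

  coprime⇒invertible : ∀ n M → Coprime ℤ.∣ n ∣ M → ∃[ r ] r * n ≋ 1ℤ [mod M ]
  coprime⇒invertible n M n⊥M = abs-invertible⇒invertible (fromBézout (coprime-Bézout n⊥M))
    where
    N = ℤ.∣ n ∣

    pos-identity : ∀ {a b c d e} → a ℕ.+ b ℕ.* c ≡ d ℕ.* e → + a + + b * + c ≡ + d * + e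
    pos-identity {a} {b} {c} {d} {e} eq = begin
      + a + + b * + c     ≡⟨ cong (λ t → + a + t) (ℤ.pos-* b c) ⟨
      + a + + (b ℕ.* c)   ≡⟨ ℤ.pos-+ a (b ℕ.* c) ⟨
      + (a ℕ.+ b ℕ.* c)   ≡⟨ cong +_ eq ⟩
      + (d ℕ.* e)         ≡⟨ ℤ.pos-* d e ⟩
      + d * + e           ∎
      where open ≡-Reasoning

    fromBézout : Bézout.Identity 1 N M → ∃[ r ] r * + N ≋ 1ℤ [mod M ]
    fromBézout (Bézout.+- x y eq) =
      + x , mk≋ (divides (+ y)
        (subst (λ t → t - 1ℤ ≡ + y * + M) (pos-identity {1} {y} {M} {x} {N} eq) (cancel (+ y * + M))))
      where
      cancel : ∀ t → (1ℤ + t) - 1ℤ ≡ t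
      cancel = solve-∀
    fromBézout (Bézout.-+ x y eq) =
      - + x , mk≋ (divides (- + y) (trans
        (subst (λ t → (- + x) * + N - 1ℤ ≡ - t) (pos-identity {1} {x} {N} {y} {M} eq) (negate (+ x) (+ N)))
        (ℤ.neg-distribˡ-* (+ y) (+ M))))
      where
      negate : ∀ x n → (- x) * n - 1ℤ ≡ - (1ℤ + x * n)
      negate = solve-∀

  ^-∸-* : ∀ p {m n} → m ≤ n → p ^ (n ℕ.∸ m) ℕ.* p ^ m ≡ p ^ n
  ^-∸-* p {m} {n} m≤n = trans (sym (ℕ.^-distribˡ-+-* p (n ℕ.∸ m) m)) (cong (p ^_) (ℕ.m∸n+n≡m m≤n))

  ^-∣ : ∀ p {m n} → m ≤ n → p ^ m ℕ.∣ p ^ n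
  ^-∣ p {m} {n} m≤n = ℕ.divides (p ^ (n ℕ.∸ m)) (sym (^-∸-* p m≤n))

  m∣m^n : ∀ m {n} → 0 < n → m ℕ.∣ m ^ n
  m∣m^n m {suc n} _ = ℕ.m∣m*n (m ^ n)

  prime⇒1<p : ∀ {p} → Prime p → 1 < p
  prime⇒1<p {p} p-prime = ℕ.nonTrivial⇒n>1 p {{prime⇒nonTrivial p-prime}}

  module _ {p : ℕ} (p-prime : Prime p) where

    euclidsLemmaℤ : ∀ a b → + p ∣ a * b → + p ∣ a ⊎ + p ∣ b
    euclidsLemmaℤ a b p∣ab
      with euclidsLemma ℤ.∣ a ∣ ℤ.∣ b ∣ p-prime (subst (p ℕ.∣_) (ℤ.abs-* a b) (∣⇒∣ᵤ p∣ab))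
    ... | inj₁ p∣a = inj₁ (∣ᵤ⇒∣ p∣a)
    ... | inj₂ p∣b = inj₂ (∣ᵤ⇒∣ p∣b)

    ∤⇒coprime : ∀ {n} → ¬ (p ℕ.∣ n) → Coprime n p
    ∤⇒coprime p∤n (d∣n , d∣p) with prime⇒irreducible p-prime d∣p
    ... | inj₁ d≡1 = d≡1
    ... | inj₂ refl = contradiction d∣n p∤n

    ∤⇒invertible : ∀ {n} → ¬ (+ p ∣ n) → ∀ k → ∃[ r ] r * n ≋ 1ℤ [mod p ^ k ]
    ∤⇒invertible {n} p∤n k = coprime⇒invertible n (p ^ k) (coprime-^ (∤⇒coprime (p∤n ∘ ∣ᵤ⇒∣)) k)

    ∤p^⇒p^e*unit : ∀ {m n} → ¬ (+ (p ^ m) ∣ n) →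
                   ∃[ e ] e < m × ∃[ n′ ] ¬ (+ p ∣ n′) × n ≡ + (p ^ e) * n′
    ∤p^⇒p^e*unit {zero}  {n} 1∤n = contradiction (∣ᵤ⇒∣ (ℕ.1∣ ℤ.∣ n ∣)) 1∤n
    ∤p^⇒p^e*unit {suc m} {n} p^1+m∤n with + (p ^ m) ∣? n
    ... | no p^m∤n = let (e , e<m , rest) = ∤p^⇒p^e*unit p^m∤n in e , ℕ.m<n⇒m<1+n e<m , rest
    ... | yes (divides q n≡qp^m) with + p ∣? q
    ...   | no p∤q = m , ℕ.n<1+n m , q , p∤q , trans n≡qp^m (ℤ.*-comm q _)
    ...   | yes (divides r q≡rp) = contradiction (divides r (begin
              n                       ≡⟨ n≡qp^m ⟩
              q * + (p ^ m)           ≡⟨ cong (_* + (p ^ m)) q≡rp ⟩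
              r * + p * + (p ^ m)     ≡⟨ ℤ.*-assoc r (+ p) _ ⟩
              r * (+ p * + (p ^ m))   ≡⟨ cong (r *_) (ℤ.pos-* p (p ^ m)) ⟨
              r * + (p ^ suc m)       ∎)) p^1+m∤n
      where open ≡-Reasoning

  -- The residue system reps N and the orbit predicates

  reps≡cartesianProduct : ∀ N → reps N ≡ cartesianProductWith (λ i j → (+ i , + j)) (upTo N) (upTo N)
  reps≡cartesianProduct N = go (upTo N)
    where
    go : ∀ is → concatMap (λ i → map (λ j → (+ i , + j)) (upTo N)) is
              ≡ cartesianProductWith (λ i j → (+ i , + j)) is (upTo N)
    go []       = refl
    go (i ∷ is) = cong (map (λ j → (+ i , + j)) (upTo N) ++_) (go is)

  module _ {N : ℕ} where

    reps-∈ : ∀ {i j} → i < N → j < N → (+ i , + j) ∈ reps N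
    reps-∈ i<N j<N =
      subst (_ ∈_) (sym (reps≡cartesianProduct N)) (∈-cartesianProductWith⁺ _ (∈-upTo⁺ i<N) (∈-upTo⁺ j<N))

    reps-∈⁻ : ∀ {x} → x ∈ reps N → ∃[ i ] ∃[ j ] i < N × j < N × x ≡ (+ i , + j)
    reps-∈⁻ x∈reps
      with i , j , i∈ , j∈ , eq ←
             ∈-cartesianProductWith⁻ _ (upTo N) (upTo N) (subst (_ ∈_) (reps≡cartesianProduct N) x∈reps)
      = i , j , ∈-upTo⁻ i∈ , ∈-upTo⁻ j∈ , eq

    reps-unique : Unique (reps N)
    reps-unique = subst Unique (sym (reps≡cartesianProduct N))
      (Unique.cartesianProductWith⁺ _ pair-injective (Unique.upTo⁺ N) (Unique.upTo⁺ N))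
      where
      pair-injective : ∀ {i i′ j j′} → (+ i , + j) ≡ (+ i′ , + j′) → i ≡ i′ × j ≡ j′
      pair-injective refl = refl , refl

    residues-≋⇒≡ : ∀ {i j} → i < N → j < N → + i ≋ + j [mod N ] → i ≡ j
    residues-≋⇒≡ {i} {j} i<N j<N (mk≋ N∣i-j) with ℤ.∣ + i - + j ∣ in eq
    ... | zero  = ℤ.+-injective (ℤ.i-j≡0⇒i≡j (+ i) (+ j) (ℤ.∣i∣≡0⇒i≡0 eq))
    ... | suc d = ⊥-elim (ℕ.>⇒∤ d<N (subst (N ℕ.∣_) eq (∣⇒∣ᵤ N∣i-j)))
      where
      d<N : suc d < N
      d<N = subst (ℕ._< N) eq (begin-strict
        ℤ.∣ + i - + j ∣   ≡⟨ cong ℤ.∣_∣ (ℤ.m-n≡m⊖n i j) ⟩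
        ℤ.∣ i ℤ.⊖ j ∣     ≤⟨ ℤ.∣m⊝n∣≤m⊔n i j ⟩
        i ℕ.⊔ j           <⟨ ℕ.⊔-lub i<N j<N ⟩
        N                 ∎)
        where open ℕ.≤-Reasoning

    reps-≈⇒≡ : ∀ {x y} → x ∈ reps N → y ∈ reps N → x ≈ y [mod N ] → x ≡ y
    reps-≈⇒≡ x∈reps y∈reps (h ,≈ k)
      with i , j , i<N , j<N , refl ← reps-∈⁻ x∈reps
         | i′ , j′ , i′<N , j′<N , refl ← reps-∈⁻ y∈reps
      = cong₂ (λ a b → (+ a , + b)) (residues-≋⇒≡ i<N i′<N h) (residues-≋⇒≡ j<N j′<N k)

  module _ (N : ℕ) .{{_ : NonZero N}} where

    reduce : El → El
    reduce (a , b) = (+ (a %ℕ N) , + (b %ℕ N))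

    reduce-∈ : ∀ x → reduce x ∈ reps N
    reduce-∈ (a , b) = reps-∈ (n%ℕd<d a N) (n%ℕd<d b N)

    %ℕ-≋ : ∀ a → + (a %ℕ N) ≋ a [mod N ]
    %ℕ-≋ a = mk≋ (divides (- (a /ℕ N)) (begin
      + (a %ℕ N) - a                        ≡⟨ cong (λ t → + (a %ℕ N) - t) (a≡a%ℕn+[a/ℕn]*n a N) ⟩
      + (a %ℕ N) - (+ (a %ℕ N) + a /ℕ N * + N) ≡⟨ cancel (+ (a %ℕ N)) (a /ℕ N) (+ N) ⟩
      - (a /ℕ N) * + N                      ∎))
      where
      open ≡-Reasoning
      cancel : ∀ r q n → r - (r + q * n) ≡ (- q) * n
      cancel = solve-∀

    reduce-≈ : ∀ x → reduce x ≈ x [mod N ]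
    reduce-≈ (a , b) = %ℕ-≋ a ,≈ %ℕ-≋ b

    ∣⇒%ℕ≡0 : ∀ {a} → + N ∣ a → a %ℕ N ≡ 0
    ∣⇒%ℕ≡0 {a} N∣a =
      residues-≋⇒≡ (n%ℕd<d a N) (ℕ.>-nonZero⁻¹ N) (≋-trans (%ℕ-≋ a) (mk≋ (∣-≡ (ℤ.+-identityʳ a) N∣a)))

    [a/N]*N≡a : ∀ {a} → + N ∣ a → a / + N * + N ≡ a
    [a/N]*N≡a {a} N∣a = begin
      a / + N * + N                  ≡⟨ cong (_* + N) (div-pos-is-/ℕ a N) ⟩
      a /ℕ N * + N                   ≡⟨ ℤ.+-identityˡ _ ⟨
      + 0 + a /ℕ N * + N             ≡⟨ cong (λ r → + r + a /ℕ N * + N) (∣⇒%ℕ≡0 N∣a) ⟨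
      + (a %ℕ N) + a /ℕ N * + N      ≡⟨ a≡a%ℕn+[a/ℕn]*n a N ⟨
      a                              ∎
      where open ≡-Reasoning

  T-does⇔ : ∀ {A : Set} (a? : Dec A) → T (does a?) ⇔ A
  T-does⇔ (yes a) = mk⇔ (λ _ → a) _
  T-does⇔ (no ¬a) = mk⇔ (λ ()) ¬a

  congO?⇔≈ : ∀ {N x y} → T (congO? N x y) ⇔ x ≈ y [mod N ]
  congO?⇔≈ {N} {a , b} {c , d} = mk⇔
    (λ t → let (h , k) = Equivalence.to T-∧ t
           in mk≋ (Equivalence.to (T-does⇔ (+ N ∣? (a - c))) h)
               ,≈ mk≋ (Equivalence.to (T-does⇔ (+ N ∣? (b - d))) k))
    (λ { (mk≋ h ,≈ mk≋ k) → Equivalence.from T-∧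
           (Equivalence.from (T-does⇔ (+ N ∣? (a - c))) h , Equivalence.from (T-does⇔ (+ N ∣? (b - d))) k) })

  module _ (Δ : ℤ) where
    open Order Δ

    Unit : ℕ → El → Set
    Unit N u = ∃[ w ] u · w ≈ ι 1ℤ [mod N ]

    InOrbit : ℕ → El → El → Set
    InOrbit N Q x = ∃[ u ] Unit N u × u · Q ≈ x [mod N ]

    Unit-resp-≈ : ∀ {N u v} → u ≈ v [mod N ] → Unit N u → Unit N v
    Unit-resp-≈ u≈v (w , uw≈1) = w , ≈-trans (·-cong (≈-sym u≈v) (≈-refl {x = w})) uw≈1

    module _ {N : ℕ} .{{_ : NonZero N}} where

      isUnit?⇔Unit : ∀ {u} → T (isUnit? Δ N u) ⇔ Unit N u
      isUnit?⇔Unit {u} = mk⇔ sound complete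
        where
        sound : T (isUnit? Δ N u) → Unit N u
        sound t with w , _ , uw≡1 ← find (any⁻ _ (reps N) t) = w , Equivalence.to congO?⇔≈ uw≡1
        complete : Unit N u → T (isUnit? Δ N u)
        complete (w , uw≈1) =
          any⁺ _ (lose (reduce-∈ N w)
            (Equivalence.from congO?⇔≈ (≈-trans (·-cong (≈-refl {x = u}) (reduce-≈ N w)) uw≈1)))

      inOrbit?⇔InOrbit : ∀ {Q x} → T (inOrbit? Δ N Q x) ⇔ InOrbit N Q x
      inOrbit?⇔InOrbit {Q} {x} = mk⇔ sound complete
        where
        sound : T (inOrbit? Δ N Q x) → InOrbit N Q x
        sound t with u , _ , t′ ← find (any⁻ _ (reps N) t) =
          let (unit , uQ≡x) = Equivalence.to (T-∧ {isUnit? Δ N u}) t′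
          in u , Equivalence.to (isUnit?⇔Unit {u}) unit , Equivalence.to congO?⇔≈ uQ≡x
        complete : InOrbit N Q x → T (inOrbit? Δ N Q x)
        complete (u , unit , uQ≈x) = any⁺ _ (lose (reduce-∈ N u)
          (Equivalence.from (T-∧ {isUnit? Δ N (reduce N u)})
            ( Equivalence.from (isUnit?⇔Unit {reduce N u}) (Unit-resp-≈ (≈-sym (reduce-≈ N u)) unit)
            , Equivalence.from congO?⇔≈ (≈-trans (·-cong (reduce-≈ N u) (≈-refl {x = Q})) uQ≈x))))

  module _ {Δ : ℤ} where

    InOrbit-resp-≈ : ∀ {N Q x y} → x ≈ y [mod N ] → InOrbit Δ N Q x → InOrbit Δ N Q y
    InOrbit-resp-≈ x≈y (u , unit , uQ≈x) = u , unit , ≈-trans uQ≈x x≈y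

    InOrbit-weaken : ∀ {M N Q x} → M ℕ.∣ N → InOrbit Δ N Q x → InOrbit Δ M Q x
    InOrbit-weaken M∣N (u , (w , uw≈1) , uQ≈x) = u , (w , ≈-weaken M∣N uw≈1) , ≈-weaken M∣N uQ≈x

    inOrbit?-reduce : ∀ {M N Q} .{{_ : NonZero M}} .{{_ : NonZero N}} →
      (∀ {x} → InOrbit Δ M Q x → InOrbit Δ N Q x) → M ℕ.∣ N →
      ∀ x → inOrbit? Δ N Q x ≡ inOrbit? Δ M Q (reduce M x)
    inOrbit?-reduce {M} {N} {Q} lift M∣N x = ⇔→≡ {z = true} (⇔.trans (⇔.sym T-≡) (⇔.trans T⇔T T-≡))
      where
      T⇔T : T (inOrbit? Δ N Q x) ⇔ T (inOrbit? Δ M Q (reduce M x))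
      T⇔T = ⇔.trans (inOrbit?⇔InOrbit Δ) (⇔.trans (mk⇔
        (InOrbit-resp-≈ (≈-sym (reduce-≈ M x)) ∘ InOrbit-weaken M∣N)
        (lift ∘ InOrbit-resp-≈ (reduce-≈ M x))) (⇔.sym (inOrbit?⇔InOrbit Δ)))

  module _ {p : ℕ} (p-prime : Prime p) (Δ : ℤ) where
    open Order Δ

    p∤1 : ¬ (+ p ∣ 1ℤ)
    p∤1 p∣1 = ℕ.<-irrefl (sym (ℕ.∣1⇒≡1 (∣⇒∣ᵤ p∣1))) (prime⇒1<p p-prime)

    Unit⇒p∤norm : ∀ {M u} → p ℕ.∣ M → Unit Δ M u → ¬ (+ p ∣ norm u)
    Unit⇒p∤norm {M} {u} p∣M (w , uw≈1) p∣Nu = p∤1 (≋-∣ (≋-sym Nuw≋1) p∣Nuw)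
      where
      Nuw≋1 : norm (u · w) ≋ 1ℤ [mod p ]
      Nuw≋1 = ≋-weaken p∣M (subst (λ t → norm (u · w) ≋ t [mod M ]) norm-ι1 (norm-cong uw≈1))
      p∣Nuw : + p ∣ norm (u · w)
      p∣Nuw = subst (+ p ∣_) (sym (norm-· u w)) (∣m⇒∣m*n (norm w) p∣Nu)

    p∤norm⇒Unit : ∀ {u} → ¬ (+ p ∣ norm u) → ∀ k → Unit Δ (p ^ k) u
    p∤norm⇒Unit {u} p∤Nu k with r , rNu≋1 ← ∤⇒invertible p-prime p∤Nu k =
      ι r · conj u , ≈-trans (≈-reflexive u·r·conj-u≡ι[rNu]) (ι-cong rNu≋1)
      where
      open ≡-Reasoning
      u·r·conj-u≡ι[rNu] : u · (ι r · conj u) ≡ ι (r * norm u)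
      u·r·conj-u≡ι[rNu] = begin
        u · (ι r · conj u)   ≡⟨ ·-assoc u (ι r) (conj u) ⟨
        (u · ι r) · conj u   ≡⟨ cong (_· conj u) (·-comm u (ι r)) ⟩
        (ι r · u) · conj u   ≡⟨ ·-assoc (ι r) u (conj u) ⟩
        ι r · (u · conj u)   ≡⟨ cong (ι r ·_) (·-conj u) ⟩
        ι r · ι (norm u)     ≡⟨ ι-·-ι r (norm u) ⟩
        ι (r * norm u)       ∎

    -- With N(Q) = p^e n′ and r n′ ≡ 1, the unit v = u + p^(m−e) r z·conj Q satisfies
    -- v·Q = u·Q + p^m (r n′) z ≡ x, and v ≡ u (mod p).
    InOrbit-lift : ∀ {m Q x} → ¬ (+ (p ^ m) ∣ norm Q) → InOrbit Δ (p ^ m) Q x → ∀ a → InOrbit Δ (p ^ a) Q x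
    InOrbit-lift {m} {Q} {x} p^m∤NQ (u , u-unit , uQ≈x) a
      with e , e<m , n′ , p∤n′ , NQ≡p^en′ ← ∤p^⇒p^e*unit p-prime p^m∤NQ
      = v , p∤norm⇒Unit {u = v} p∤Nv a , vQ≈x
      where
      r : ℤ
      r = proj₁ (∤⇒invertible p-prime p∤n′ a)
      rn′≋1 : r * n′ ≋ 1ℤ [mod p ^ a ]
      rn′≋1 = proj₂ (∤⇒invertible p-prime p∤n′ a)
      z : El
      z = proj₁ (≈⇒≡⊕smul (≈-sym uQ≈x))
      x≡uQ⊕p^mz : x ≡ u · Q ⊕ smul (+ (p ^ m)) z
      x≡uQ⊕p^mz = proj₂ (≈⇒≡⊕smul (≈-sym uQ≈x))
      k : ℤ
      k = + (p ^ (m ℕ.∸ e)) * r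
      t : El
      t = z · conj Q
      v : El
      v = u ⊕ ι k · t

      kNQ≡p^m*rn′ : k * norm Q ≡ + (p ^ m) * (r * n′)
      kNQ≡p^m*rn′ = begin
        + (p ^ (m ℕ.∸ e)) * r * norm Q                  ≡⟨ cong (+ (p ^ (m ℕ.∸ e)) * r *_) NQ≡p^en′ ⟩
        + (p ^ (m ℕ.∸ e)) * r * (+ (p ^ e) * n′)        ≡⟨ regroup (+ (p ^ (m ℕ.∸ e))) r (+ (p ^ e)) n′ ⟩
        + (p ^ (m ℕ.∸ e)) * + (p ^ e) * (r * n′)        ≡⟨ cong (_* (r * n′)) (ℤ.pos-* (p ^ (m ℕ.∸ e)) (p ^ e)) ⟨
        + (p ^ (m ℕ.∸ e) ℕ.* p ^ e) * (r * n′)          ≡⟨ cong (λ j → + j * (r * n′)) (^-∸-* p (ℕ.<⇒≤ e<m)) ⟩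
        + (p ^ m) * (r * n′)                            ∎
        where
        open ≡-Reasoning
        regroup : ∀ a r b n → a * r * (b * n) ≡ a * b * (r * n)
        regroup = solve-∀

      kNQ≋p^m : k * norm Q ≋ + (p ^ m) [mod p ^ a ]
      kNQ≋p^m = ≋-trans (≋-reflexive kNQ≡p^m*rn′)
        (≋-trans (≋-* (≋-refl {a = + (p ^ m)}) rn′≋1) (≋-reflexive (ℤ.*-identityʳ _)))

      vQ≈x : v · Q ≈ x [mod p ^ a ]
      vQ≈x = begin
        (u ⊕ ι k · t) · Q               ≡⟨ ·-distribʳ-⊕ Q u (ι k · t) ⟩
        u · Q ⊕ (ι k · t) · Q           ≡⟨ cong (u · Q ⊕_) (·-assoc (ι k) t Q) ⟩
        u · Q ⊕ ι k · (t · Q)           ≡⟨ cong (λ w → u · Q ⊕ ι k · w) (conj-·-cancel z Q) ⟩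
        u · Q ⊕ ι k · (ι (norm Q) · z)  ≡⟨ cong (u · Q ⊕_) (·-assoc (ι k) (ι (norm Q)) z) ⟨
        u · Q ⊕ (ι k · ι (norm Q)) · z  ≡⟨ cong (λ w → u · Q ⊕ w · z) (ι-·-ι k (norm Q)) ⟩
        u · Q ⊕ ι (k * norm Q) · z      ≡⟨ cong (u · Q ⊕_) (ι-· (k * norm Q) z) ⟩
        u · Q ⊕ smul (k * norm Q) z     ≈⟨ ⊕-cong (≈-refl {x = u · Q}) (smul-cong kNQ≋p^m (≈-refl {x = z})) ⟩
        u · Q ⊕ smul (+ (p ^ m)) z      ≡⟨ x≡uQ⊕p^mz ⟨
        x                               ∎
        where open import Relation.Binary.Reasoning.Setoid (≈-setoid (p ^ a))

      p∣k : + p ∣ k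
      p∣k = ∣m⇒∣m*n {m = + (p ^ (m ℕ.∸ e))} r (∣ᵤ⇒∣ (m∣m^n p (ℕ.m<n⇒0<n∸m e<m)))

      p∤Nv : ¬ (+ p ∣ norm v)
      p∤Nv p∣Nv =
        Unit⇒p∤norm {u = u} (m∣m^n p (ℕ.≤-<-trans z≤n e<m)) u-unit (≋-∣ (norm-cong (≈-sym v≈u)) p∣Nv)
        where
        v≈u : v ≈ u [mod p ]
        v≈u = subst (λ w → u ⊕ w ≈ u [mod p ]) (sym (ι-· k t)) (⊕-smul-≈ u t p∣k)

  module _ {Δ : ℤ} (disc : IsImagQuadDisc Δ) where
    open Order Δ

    -- cst Δ is defined by integer division, which is exact since Δ ≡ 0, 1 (mod 4).
    4*cst≡Δ²-Δ : + 4 * cst Δ ≡ Δ * Δ - Δ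
    4*cst≡Δ²-Δ = trans (ℤ.*-comm (+ 4) (cst Δ)) ([a/N]*N≡a 4 4∣Δ²-Δ)
      where
      factor : ∀ D → D * D - D ≡ D * (D - + 1)
      factor = solve-∀
      4∣Δ²-Δ : + 4 ∣ Δ * Δ - Δ
      4∣Δ²-Δ with proj₂ disc
      ... | inj₁ 4∣Δ   = ∣-≡ (factor Δ) (∣m⇒∣m*n (Δ - + 1) 4∣Δ)
      ... | inj₂ 4∣Δ-1 = ∣-≡ (factor Δ) (∣n⇒∣m*n Δ 4∣Δ-1)

    4*norm≡[2x+Δy]²-Δy² : ∀ x y → + 4 * norm (x , y) ≡ (+ 2 * x + Δ * y) * (+ 2 * x + Δ * y) - Δ * y * y
    4*norm≡[2x+Δy]²-Δy² x y = begin
      + 4 * norm (x , y)                                  ≡⟨ complete-square x y Δ (cst Δ) ⟩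
      X * X - Δ * y * y + y * y * (+ 4 * cst Δ - (Δ * Δ - Δ))
        ≡⟨ cong (λ c → X * X - Δ * y * y + y * y * (c - (Δ * Δ - Δ))) 4*cst≡Δ²-Δ ⟩
      X * X - Δ * y * y + y * y * ((Δ * Δ - Δ) - (Δ * Δ - Δ)) ≡⟨ cancel X y Δ ⟩
      X * X - Δ * y * y                                   ∎
      where
      open ≡-Reasoning
      X = + 2 * x + Δ * y
      complete-square : ∀ x y D C → + 4 * (x * x + D * x * y + C * y * y)
        ≡ (+ 2 * x + D * y) * (+ 2 * x + D * y) - D * y * y + y * y * (+ 4 * C - (D * D - D))
      complete-square = solve-∀
      cancel : ∀ X y D → X * X - D * y * y + y * y * ((D * D - D) - (D * D - D)) ≡ X * X - D * y * y
      cancel = solve-∀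

  module _ {p : ℕ} (p-prime : Prime p) (p≢2 : p ≢ 2)
           {Δ : ℤ} (disc : IsImagQuadDisc Δ) (¬leg : ¬ LegendreIsOne Δ p) where
    open Order Δ

    private instance
      p≢0 : NonZero p
      p≢0 = prime⇒nonZero p-prime

    p∤2 : ¬ (+ p ∣ + 2)
    p∤2 p∣2 = p≢2 (ℕ.≤-antisym (ℕ.∣⇒≤ (∣⇒∣ᵤ p∣2)) (prime⇒1<p p-prime))

    p∤4 : ¬ (+ p ∣ + 4)
    p∤4 p∣4 with euclidsLemmaℤ p-prime (+ 2) (+ 2) p∣4
    ... | inj₁ p∣2 = p∤2 p∣2
    ... | inj₂ p∣2 = p∤2 p∣2

    p∣2a⇒p∣a : ∀ {a} → + p ∣ + 2 * a → + p ∣ a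
    p∣2a⇒p∣a {a} p∣2a = [ flip contradiction p∤2 , id ]′ (euclidsLemmaℤ p-prime (+ 2) a p∣2a)

    p∣a²⇒p∣a : ∀ {a} → + p ∣ a * a → + p ∣ a
    p∣a²⇒p∣a {a} p∣a² = [ id , id ]′ (euclidsLemmaℤ p-prime a a p∣a²)

    module _ {x y : ℤ} (p∤xy : ¬ (+ p ∣ x × + p ∣ y)) (p∣N : + p ∣ norm (x , y)) where

      private
        X : ℤ
        X = + 2 * x + Δ * y

        X²≡4N+Δy² : X * X ≡ + 4 * norm (x , y) + Δ * y * y
        X²≡4N+Δy² = trans (move (X * X) (Δ * y * y)) (cong (_+ Δ * y * y) (sym (4*norm≡[2x+Δy]²-Δy² disc x y)))
          where
          move : ∀ a b → a ≡ (a - b) + b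
          move = solve-∀

        p∣4N : + p ∣ + 4 * norm (x , y)
        p∣4N = ∣n⇒∣m*n (+ 4) p∣N

      p∣Δy⇒p∣x : + p ∣ Δ * y → + p ∣ x
      p∣Δy⇒p∣x p∣Δy = p∣2a⇒p∣a (∣-≡ (isolate x y Δ) (∣m∣n⇒∣m-n p∣X p∣Δy))
        where
        p∣X : + p ∣ X
        p∣X = p∣a²⇒p∣a (∣-≡ X²≡4N+Δy² (∣m∣n⇒∣m+n p∣4N (∣m⇒∣m*n y p∣Δy)))
        isolate : ∀ x y D → + 2 * x ≡ (+ 2 * x + D * y) - D * y
        isolate = solve-∀

      -- If p ∤ Δ and p ∤ y, then Δ ≡ (X y⁻¹)² (mod p) because 4N(x, y) = X² − Δy².
      p∣Δ : + p ∣ Δ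
      p∣Δ with + p ∣? Δ | + p ∣? y
      ... | yes p∣Δ | _       = p∣Δ
      ... | no p∤Δ  | yes p∣y = contradiction (p∣Δy⇒p∣x (∣n⇒∣m*n Δ p∣y) , p∣y) p∤xy
      ... | no p∤Δ  | no p∤y  = contradiction (p∤Δ , X * yi , p∣[Xyi]²-Δ) ¬leg
        where
        inverse = ∤⇒invertible p-prime p∤y 1
        yi = proj₁ inverse
        p∣yiy-1 : + p ∣ yi * y - 1ℤ
        p∣yiy-1 = ∣-trans (∣ᵤ⇒∣ (m∣m^n p {1} (ℕ.s≤s ℕ.z≤n))) (∣-diff (proj₂ inverse))
        expand : ∀ X yi y D →
          X * yi * (X * yi) - D ≡ yi * yi * (X * X - D * y * y) + D * ((yi * y - 1ℤ) * (yi * y + 1ℤ))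
        expand = solve-∀
        p∣[Xyi]²-Δ : + p ∣ X * yi * (X * yi) - Δ
        p∣[Xyi]²-Δ = ∣-≡ (expand X yi y Δ) (∣m∣n⇒∣m+n
          (∣n⇒∣m*n (yi * yi) (subst (+ p ∣_) (4*norm≡[2x+Δy]²-Δy² disc x y) p∣4N))
          (∣n⇒∣m*n Δ (∣m⇒∣m*n (yi * y + 1ℤ) p∣yiy-1)))

      p∣x : + p ∣ x
      p∣x = p∣Δy⇒p∣x (∣m⇒∣m*n y p∣Δ)

      p∤y : ¬ (+ p ∣ y)
      p∤y p∣y = p∤xy (p∣x , p∣y)

      p∣cst : + p ∣ cst Δ
      p∣cst = [ flip contradiction p∤4 , id ]′ (euclidsLemmaℤ p-prime (+ 4) (cst Δ) p∣4cst)
        where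
        p∣4cst : + p ∣ + 4 * cst Δ
        p∣4cst = subst (+ p ∣_) (sym (4*cst≡Δ²-Δ disc)) (∣m∣n⇒∣m-n (∣m⇒∣m*n Δ p∣Δ) p∣Δ)

      p∣fst⇒p∣norm : ∀ {a b} → + p ∣ a → + p ∣ norm (a , b)
      p∣fst⇒p∣norm {a} {b} p∣a =
        ∣m∣n⇒∣m+n (∣m∣n⇒∣m+n (∣m⇒∣m*n a p∣a) (∣m⇒∣m*n b (∣m⇒∣m*n a p∣Δ))) (∣m⇒∣m*n b (∣m⇒∣m*n b p∣cst))

      -- The unit u = a + bω is congruent to s₀ + l·conj Q for l = −b y⁻¹, and conj Q · Q = N(Q) ≡ 0.
      InOrbit⇒multiple : ∀ {k z} → 0 < k → + (p ^ k) ∣ norm (x , y) → InOrbit Δ (p ^ k) (x , y) z →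
                         ∃[ s ] s < p ^ k × ¬ (p ℕ.∣ s) × z ≈ smul (+ s) (x , y) [mod p ^ k ]
      InOrbit⇒multiple {k} {z} 0<k p^k∣N ((a , b) , u-unit , uQ≈z) = s , n%ℕd<d s₀ (p ^ k) , p∤s , z≈sQ
        where
        instance
          p^k≢0 : NonZero (p ^ k)
          p^k≢0 = ℕ.m^n≢0 p k
        Q = (x , y)
        u = (a , b)
        yi = proj₁ (∤⇒invertible p-prime p∤y k)
        yiy≋1 : yi * y ≋ 1ℤ [mod p ^ k ]
        yiy≋1 = proj₂ (∤⇒invertible p-prime p∤y k)
        l = - (b * yi)
        s₀ = a - l * (x + y * Δ)
        s = s₀ %ℕ (p ^ k)
        w = ι s₀ ⊕ ι l · conj Q

        split : ∀ a l t → a ≡ (a - l * t) + l * t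
        split = solve-∀

        u≈w : u ≈ w [mod p ^ k ]
        u≈w = ≈-trans
          (≋-reflexive (split a l (x + y * Δ)) ,≈ mk≋ (∣-≡ (unwind b yi y) (∣n⇒∣m*n (- b) (∣-diff yiy≋1))))
          (≈-reflexive (cong (ι s₀ ⊕_) (sym (ι-· l (conj Q)))))
          where
          unwind : ∀ b yi y → b - (0ℤ + (- (b * yi)) * (- y)) ≡ (- b) * (yi * y - 1ℤ)
          unwind = solve-∀

        wQ≈s₀Q : w · Q ≈ smul s₀ Q [mod p ^ k ]
        wQ≈s₀Q = begin
          (ι s₀ ⊕ ι l · conj Q) · Q              ≡⟨ ·-distribʳ-⊕ Q (ι s₀) (ι l · conj Q) ⟩
          ι s₀ · Q ⊕ (ι l · conj Q) · Q          ≡⟨ cong₂ _⊕_ (ι-· s₀ Q) (conj-·-cancel (ι l) Q) ⟩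
          smul s₀ Q ⊕ ι (norm Q) · ι l           ≡⟨ cong (smul s₀ Q ⊕_) (ι-· (norm Q) (ι l)) ⟩
          smul s₀ Q ⊕ smul (norm Q) (ι l)        ≈⟨ ⊕-smul-≈ (smul s₀ Q) (ι l) p^k∣N ⟩
          smul s₀ Q                              ∎
          where open import Relation.Binary.Reasoning.Setoid (≈-setoid (p ^ k))

        z≈sQ : z ≈ smul (+ s) Q [mod p ^ k ]
        z≈sQ = begin
          z             ≈⟨ ≈-sym uQ≈z ⟩
          u · Q         ≈⟨ ·-cong u≈w (≈-refl {x = Q}) ⟩
          w · Q         ≈⟨ wQ≈s₀Q ⟩
          smul s₀ Q     ≈⟨ smul-cong (≋-sym (%ℕ-≋ (p ^ k) s₀)) (≈-refl {x = Q}) ⟩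
          smul (+ s) Q  ∎
          where open import Relation.Binary.Reasoning.Setoid (≈-setoid (p ^ k))

        p∤s : ¬ (p ℕ.∣ s)
        p∤s p∣s = Unit⇒p∤norm p-prime Δ {u = u} (m∣m^n p 0<k) u-unit (p∣fst⇒p∣norm {b = b} p∣a)
          where
          p∣s₀ : + p ∣ s₀
          p∣s₀ = ≋-∣ (≋-weaken (m∣m^n p 0<k) (≋-sym (%ℕ-≋ (p ^ k) s₀))) (∣ᵤ⇒∣ p∣s)
          p∣a : + p ∣ a
          p∣a = ∣-≡ (split a l (x + y * Δ))
            (∣m∣n⇒∣m+n p∣s₀ (∣n⇒∣m*n l (∣m∣n⇒∣m+n p∣x (∣n⇒∣m*n y p∣Δ))))

  module _ {p : ℕ} (p-prime : Prime p) where

    HasAdditiveOrder⇒p∤ : ∀ {a x y} → 0 < a →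
      HasAdditiveOrder (p ^ a) (x , y) (p ^ a) → ¬ (+ p ∣ x × + p ∣ y)
    HasAdditiveOrder⇒p∤ {suc a} {x} {y} _ (_ , _ , minimal) (p∣x , p∣y) =
      minimal (p ^ a) (ℕ.m^n>0 p {{prime⇒nonZero p-prime}} a) (ℕ.^-monoʳ-< p (prime⇒1<p p-prime) (ℕ.n<1+n a))
        (p^a*-annihilates p∣x , p^a*-annihilates p∣y)
      where
      p^a*-annihilates : ∀ {t} → + p ∣ t → + (p ^ suc a) ∣ + (p ^ a) * t - + 0
      p^a*-annihilates {t} (divides q t≡qp) = divides q (begin
        + (p ^ a) * t - + 0            ≡⟨ cong (λ t → + (p ^ a) * t - + 0) t≡qp ⟩
        + (p ^ a) * (q * + p) - + 0  ≡⟨ regroup (+ (p ^ a)) q (+ p) ⟩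
        q * (+ p * + (p ^ a))        ≡⟨ cong (q *_) (ℤ.pos-* p (p ^ a)) ⟨
        q * + (p ^ suc a)              ∎)
        where
        open ≡-Reasoning
        regroup : ∀ A q P → A * (q * P) - + 0 ≡ q * (P * A)
        regroup = solve-∀

open import Data.Nat using (_+_; _*_; _∸_; _%_)

-- Counting

∑ : ℕ → (ℕ → ℕ) → ℕ
∑ zero    f = 0
∑ (suc n) f = f 0 + ∑ n (f ∘ suc)

infix 5 ∑
syntax ∑ n (λ i → f) = ∑[ i < n ] f

∑-cong : ∀ n {f g : ℕ → ℕ} → (∀ {i} → i < n → f i ≡ g i) → ∑ n f ≡ ∑ n g
∑-cong zero    f≡g = refl
∑-cong (suc n) f≡g = cong₂ _+_ (f≡g (s≤s z≤n)) (∑-cong n (f≡g ∘ s≤s))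

∑-+ : ∀ m n f → ∑ (m + n) f ≡ ∑ m f + (∑[ i < n ] f (m + i))
∑-+ zero    n f = refl
∑-+ (suc m) n f = trans (cong (λ t → f 0 + t) (∑-+ m n (f ∘ suc))) (sym (ℕ.+-assoc (f 0) _ _))

∑-*ˡ : ∀ n k f → (∑[ i < n ] k * f i) ≡ k * ∑ n f
∑-*ˡ zero    k f = sym (ℕ.*-zeroʳ k)
∑-*ˡ (suc n) k f = trans (cong (λ t → k * f 0 + t) (∑-*ˡ n k (f ∘ suc))) (sym (ℕ.*-distribˡ-+ k (f 0) _))

∑-periodic : ∀ K M f → (∀ i → f (M + i) ≡ f i) → ∑ (K * M) f ≡ K * ∑ M f
∑-periodic zero    M f periodic = refl
∑-periodic (suc K) M f periodic = begin
  ∑ (M + K * M) f                      ≡⟨ ∑-+ M (K * M) f ⟩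
  ∑ M f + (∑[ i < K * M ] f (M + i))   ≡⟨ cong (λ t → ∑ M f + t) (∑-cong (K * M) (λ {i} _ → periodic i)) ⟩
  ∑ M f + ∑ (K * M) f                  ≡⟨ cong (λ t → ∑ M f + t) (∑-periodic K M f periodic) ⟩
  ∑ M f + K * ∑ M f                    ∎
  where open ≡-Reasoning

∑-% : ∀ K M .{{_ : NonZero M}} f → (∑[ i < K * M ] f (i % M)) ≡ K * ∑ M f
∑-% K M f = trans
  (∑-periodic K M (f ∘ (_% M)) (λ i → cong f (trans (cong (_% M) (ℕ.+-comm M i)) ([m+n]%n≡m%n i M))))
  (cong (K *_) (∑-cong M (cong f ∘ m<n⇒m%n≡m)))

∑∑-% : ∀ K M .{{_ : NonZero M}} (G : ℕ → ℕ → ℕ) →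
  (∑[ i < K * M ] ∑[ j < K * M ] G (i % M) (j % M)) ≡ K * (K * (∑[ i < M ] ∑[ j < M ] G i j))
∑∑-% K M G = begin
  (∑[ i < K * M ] ∑[ j < K * M ] G (i % M) (j % M)) ≡⟨ ∑-cong (K * M) (λ {i} _ → ∑-% K M (G (i % M))) ⟩
  (∑[ i < K * M ] K * (∑[ j < M ] G (i % M) j))    ≡⟨ ∑-*ˡ (K * M) K _ ⟩
  K * (∑[ i < K * M ] ∑[ j < M ] G (i % M) j)      ≡⟨ cong (K *_) (∑-% K M (λ i → ∑[ j < M ] G i j)) ⟩
  K * (K * (∑[ i < M ] ∑[ j < M ] G i j))          ∎
  where open ≡-Reasoning

χ : Bool → ℕ
χ true  = 1
χ false = 0

module _ {A : Set} (g : A → Bool) where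

  length-filterᵇ-applyUpTo : ∀ h n → length (filterᵇ g (applyUpTo h n)) ≡ ∑[ i < n ] χ (g (h i))
  length-filterᵇ-applyUpTo h zero = refl
  length-filterᵇ-applyUpTo h (suc n) with g (h 0)
  ... | true  = cong suc (length-filterᵇ-applyUpTo (h ∘ suc) n)
  ... | false = length-filterᵇ-applyUpTo (h ∘ suc) n

  length-filterᵇ-concatMap : ∀ {B : Set} (H : B → List A) h n →
    length (filterᵇ g (concatMap H (applyUpTo h n))) ≡ ∑[ i < n ] length (filterᵇ g (H (h i)))
  length-filterᵇ-concatMap H h zero = refl
  length-filterᵇ-concatMap H h (suc n) = begin
    length (filterᵇ g (H (h 0) ++ concatMap H (applyUpTo (h ∘ suc) n)))
      ≡⟨ cong length (filter-++ _ (H (h 0)) _) ⟩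
    length (filterᵇ g (H (h 0)) ++ filterᵇ g (concatMap H (applyUpTo (h ∘ suc) n)))
      ≡⟨ length-++ (filterᵇ g (H (h 0))) ⟩
    length (filterᵇ g (H (h 0))) + length (filterᵇ g (concatMap H (applyUpTo (h ∘ suc) n)))
      ≡⟨ cong (λ t → length (filterᵇ g (H (h 0))) + t) (length-filterᵇ-concatMap H (h ∘ suc) n) ⟩
    length (filterᵇ g (H (h 0))) + (∑[ i < n ] length (filterᵇ g (H (h (suc i)))))
      ∎
    where open ≡-Reasoning

length-filterᵇ-reps : ∀ (g : El → Bool) N →
  length (filterᵇ g (reps N)) ≡ ∑[ i < N ] ∑[ j < N ] χ (g (+ i , + j))
length-filterᵇ-reps g N = trans
  (length-filterᵇ-concatMap g (λ i → map (λ j → (+ i , + j)) (upTo N)) id N)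
  (∑-cong N (λ {i} _ → trans (cong (length ∘ filterᵇ g) (map-applyUpTo id (λ j → (+ i , + j)) N))
                             (length-filterᵇ-applyUpTo g (λ j → (+ i , + j)) N)))

length-filterᵇ-reps-% : ∀ K M .{{_ : NonZero M}} (g h : El → Bool) →
  (∀ i j → g (+ i , + j) ≡ h (+ (i % M) , + (j % M))) →
  length (filterᵇ g (reps (K * M))) ≡ K * (K * length (filterᵇ h (reps M)))
length-filterᵇ-reps-% K M g h g≡h∘% = begin
  length (filterᵇ g (reps (K * M)))
    ≡⟨ length-filterᵇ-reps g (K * M) ⟩
  (∑[ i < K * M ] ∑[ j < K * M ] χ (g (+ i , + j)))
    ≡⟨ ∑-cong (K * M) (λ {i} _ → ∑-cong (K * M) (λ {j} _ → cong χ (g≡h∘% i j))) ⟩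
  (∑[ i < K * M ] ∑[ j < K * M ] χ (h (+ (i % M) , + (j % M))))
    ≡⟨ ∑∑-% K M (λ i j → χ (h (+ i , + j))) ⟩
  K * (K * (∑[ i < M ] ∑[ j < M ] χ (h (+ i , + j))))
    ≡⟨ cong (λ c → K * (K * c)) (length-filterᵇ-reps h M) ⟨
  K * (K * length (filterᵇ h (reps M)))
    ∎
  where open ≡-Reasoning

module _ {A : Set} where

  ∈-─⁺ : ∀ {x y} {ys : List A} (x∈ys : x ∈ ys) → y ∈ ys → x ≢ y → y ∈ (ys ─ x∈ys)
  ∈-─⁺ (here refl) (here refl)  x≢y = contradiction refl x≢y
  ∈-─⁺ (here refl) (there y∈ys) _   = y∈ys
  ∈-─⁺ (there x∈ys) (here refl) _   = here refl
  ∈-─⁺ (there x∈ys) (there y∈ys) x≢y = there (∈-─⁺ x∈ys y∈ys x≢y)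

  Unique-⊆⇒length≤ : ∀ {xs ys : List A} → Unique xs → xs ⊆ ys → length xs ≤ length ys
  Unique-⊆⇒length≤ {[]}     _                  _     = z≤n
  Unique-⊆⇒length≤ {x ∷ xs} {ys} (x∉xs ∷ xs!) x∷xs⊆ys = begin
    suc (length xs)              ≤⟨ s≤s (Unique-⊆⇒length≤ xs! xs⊆ys─x) ⟩
    suc (length (ys ─ x∈ys))     ≡⟨ length-removeAt′ ys (index x∈ys) ⟨
    length ys                    ∎
    where
    open ℕ.≤-Reasoning
    x∈ys = x∷xs⊆ys (here refl)
    xs⊆ys─x : xs ⊆ (ys ─ x∈ys)
    xs⊆ys─x y∈xs = ∈-─⁺ x∈ys (x∷xs⊆ys (there y∈xs)) (All.lookup x∉xs y∈xs)

coprimesUpTo : ℕ → List ℕ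
coprimesUpTo n = filterᵇ (λ k → gcd k n ℕ.≡ᵇ 1) (applyUpTo suc n)

module _ {p : ℕ} (p-prime : Prime p) where

  private instance
    p≢0 : NonZero p
    p≢0 = prime⇒nonZero p-prime

  ∈-coprimesUpTo : ∀ {k s} → s < p ^ k → ¬ (p ℕ.∣ s) → s ∈ coprimesUpTo (p ^ k)
  ∈-coprimesUpTo {k} {zero}  _   p∤0 = contradiction (p ℕ.∣0) p∤0
  ∈-coprimesUpTo {k} {suc s} s<M p∤s = ∈-filter⁺ (T? ∘ λ t → gcd t (p ^ k) ℕ.≡ᵇ 1)
    (∈-applyUpTo⁺ suc (ℕ.<-trans (ℕ.n<1+n s) s<M))
    (ℕ.≡⇒≡ᵇ _ _ (coprime⇒gcd≡1 (coprime-^ (∤⇒coprime p-prime p∤s) k)))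

  module _ {Δ : ℤ} where
    open Order Δ

    orbitSize-p^a : ∀ {m a Q} → m ≤ a → ¬ (+ (p ^ m) ∣ norm Q) →
      orbitSize Δ (p ^ a) Q ≡ p ^ (a ∸ m) * (p ^ (a ∸ m) * orbitSize Δ (p ^ m) Q)
    orbitSize-p^a {m} {a} {Q} m≤a p^m∤NQ =
      subst (λ N → length (filterᵇ (inOrbit? Δ (p ^ a) Q) (reps N)) ≡ K * (K * orbitSize Δ (p ^ m) Q))
        (^-∸-* p m≤a)
        (length-filterᵇ-reps-% K (p ^ m) (inOrbit? Δ (p ^ a) Q) (inOrbit? Δ (p ^ m) Q) depends-on-residue)
      where
      instance
        p^m≢0 : NonZero (p ^ m)
        p^m≢0 = ℕ.m^n≢0 p m
        p^a≢0 : NonZero (p ^ a)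
        p^a≢0 = ℕ.m^n≢0 p a
      K = p ^ (a ∸ m)
      depends-on-residue : ∀ i j →
        inOrbit? Δ (p ^ a) Q (+ i , + j) ≡ inOrbit? Δ (p ^ m) Q (+ (i % p ^ m) , + (j % p ^ m))
      depends-on-residue i j = inOrbit?-reduce {M = p ^ m} {N = p ^ a}
        (λ orbit → InOrbit-lift p-prime Δ {m = m} p^m∤NQ orbit a) (^-∣ p m≤a) (+ i , + j)

    orbitSize≤φ : p ≢ 2 → IsImagQuadDisc Δ → ¬ LegendreIsOne Δ p →
      ∀ {k x y} → 0 < k → ¬ (+ p ∣ x × + p ∣ y) → + (p ^ k) ∣ norm (x , y) →
      orbitSize Δ (p ^ k) (x , y) ≤ φ (p ^ k)
    orbitSize≤φ p≢2 disc ¬leg {k} {x} {y} 0<k p∤xy p^k∣N = begin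
      length orbit                     ≤⟨ Unique-⊆⇒length≤ (Unique.filter⁺ _ (reps-unique {N = M})) orbit⊆ ⟩
      length (map f (coprimesUpTo M))  ≡⟨ length-map f (coprimesUpTo M) ⟩
      φ M                              ∎
      where
      open ℕ.≤-Reasoning
      instance
        M≢0 : NonZero (p ^ k)
        M≢0 = ℕ.m^n≢0 p k
      M = p ^ k
      Q = (x , y)
      orbit = filterᵇ (inOrbit? Δ M Q) (reps M)
      f : ℕ → El
      f s = reduce M (smul (+ s) Q)
      orbit⊆ : orbit ⊆ map f (coprimesUpTo M)
      orbit⊆ {z} z∈orbit =
        subst (_∈ map f (coprimesUpTo M)) (sym z≡fs) (∈-map⁺ f (∈-coprimesUpTo {k = k} s<M p∤s))
        where
        z∈ = ∈-filter⁻ (T? ∘ inOrbit? Δ M Q) {xs = reps M} z∈orbit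
        multiple = InOrbit⇒multiple p-prime p≢2 disc ¬leg p∤xy (∣-trans (∣ᵤ⇒∣ (m∣m^n p 0<k)) p^k∣N) 0<k p^k∣N
                     (Equivalence.to (inOrbit?⇔InOrbit Δ) (proj₂ z∈))
        s = proj₁ multiple
        s<M = proj₁ (proj₂ multiple)
        p∤s = proj₁ (proj₂ (proj₂ multiple))
        z≡fs : z ≡ f s
        z≡fs = reps-≈⇒≡ (proj₁ z∈) (reduce-∈ M (smul (+ s) Q))
                 (≈-trans (proj₂ (proj₂ (proj₂ multiple))) (≈-sym (reduce-≈ M (smul (+ s) Q))))

lemma5p2 : (p : ℕ) → Prime p → p ≢ 2 →
    (Δ : ℤ) → IsImagQuadDisc Δ → ¬ LegendreIsOne Δ p →
    (a : ℕ) → 1 ≤ a → (P : El) → HasAdditiveOrder (p ^ a) P (p ^ a) →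
    (m : ℕ) → m ≤ a →
    φ (p ^ m) < orbitSize Δ (p ^ m) P →
    orbitSize Δ (p ^ a) P ≡ p ^ (2 * (a ∸ m)) * orbitSize Δ (p ^ m) P
lemma5p2 p p-prime p≢2 Δ disc ¬leg a 1≤a P order zero m≤a φ<orbit =
  contradiction (length-filter (T? ∘ inOrbit? Δ 1 P) (reps 1)) (ℕ.<⇒≱ φ<orbit)
lemma5p2 p p-prime p≢2 Δ disc ¬leg a 1≤a P@(x , y) order (suc m) m≤a φ<orbit = begin
  orbitSize Δ (p ^ a) P            ≡⟨ orbitSize-p^a p-prime {m = suc m} m≤a p^m∤N ⟩
  p ^ d * (p ^ d * s)              ≡⟨ ℕ.*-assoc (p ^ d) (p ^ d) s ⟨
  p ^ d * p ^ d * s                ≡⟨ cong (_* s) (ℕ.^-distribˡ-+-* p d d) ⟨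
  p ^ (d + d) * s                  ≡⟨ cong (λ e → p ^ (d + e) * s) (ℕ.+-identityʳ d) ⟨
  p ^ (2 * d) * s                  ∎
  where
  open ≡-Reasoning
  d = a ∸ suc m
  s = orbitSize Δ (p ^ suc m) P
  p^m∤N : ¬ (+ (p ^ suc m) ∣ Order.norm Δ P)
  p^m∤N p^m∣N = ℕ.<⇒≱ φ<orbit
    (orbitSize≤φ p-prime p≢2 disc ¬leg {k = suc m} (s≤s z≤n) (HasAdditiveOrder⇒p∤ p-prime {a = a} 1≤a order) p^m∣N)
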